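{- Let $b\geq 2$ be even, $k\leq n-2$, and $\mathbf{s}=s_1s_2\ldots s_k$. If $\mathbf{t}$ is the last sequence (with respect to co-Reflected Gray Code Order $\lessdot$) among the sequences of $R_n(b)$ having prefix $\mathbf{s}$, then $\mathbf{t}$ has one of the following forms: 1. $\mathbf{t}=\mathbf{s}M0\ldots0$ if $U_{k+1}$ is even and $M$ is even; 2. $\mathbf{t}=\mathbf{s}M(M+1)0\ldots0$ if $U_{k+1}$ is even and $M$ is odd; 3. $\mathbf{t}=\mathbf{s}0\ldots0$ if $U_{k+1}$ is odd, where $M=\min\{b,\max\{s_i\}_{i=1}^k+1\}$ and $U_{k+1}=\sum_{i=1}^k[s_i\neq 0 \text{ and } s_i \text{ is even}]$ (Iverson bracket).
   Context: A restricted growth function of length $n$ is an integer sequence $s_1s_2\ldots s_n$ with $s_1=0$ and $0\leq s_{i+1}\leq \max\{s_j\}_{j=1}^i+1$ for all $1\leq i\leq n-1$; $R_n$ denotes the set of these. For an integer $b\geq 1$, $R_n(b)=\{s_1\ldots s_n\in R_n : \max_i s_i\leq b\}$. The co-Reflected Gray Code Order $\lessdot$ on $\{0,1,\ldots,m-1\}^n$ ($m\geq 2$) is defined by: $\mathbf{s}=s_1\ldots s_n \lessdot \mathbf{t}=t_1\ldots t_n$ if, for the leftmost position $k$ with $s_k\neq t_k$, either $U_k$ is even and $s_k<t_k$, or $U_k$ is odd and $s_k>t_k$, where $U_k=|\{i\in\{1,\ldots,k-1\}: s_i\neq 0,\ s_i \text{ even}\}|$. -}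

module Defs where

open import Data.Nat using (ℕ; zero; suc; _+_; _≤_; _<_; _⊔_; _⊓_; _∸_)
open import Data.Nat.Divisibility using (_∣_; _∣?_)
open import Data.List using (List; []; _∷_; _++_; length; foldr; replicate)
open import Data.List.Relation.Unary.All using (All)
open import Data.Bool using (if_then_else_)
open import Data.Product using (_×_; ∃)
open import Data.Sum using (_⊎_)
open import Data.Unit using (⊤)
open import Relation.Nullary using (¬_)
open import Relation.Nullary.Decidable using (⌊_⌋)
open import Relation.Binary.PropositionalEquality using (_≡_)

Even : ℕ → Set
Even n = 2 ∣ n

Odd : ℕ → Set
Odd n = ¬ (2 ∣ n)

nzEven : ℕ → ℕ
nzEven zero    = 0
nzEven (suc x) = if ⌊ 2 ∣? suc x ⌋ then 1 else 0

-- U_{k+1} for a prefix s_1..s_k : number of nonzero even entries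
U : List ℕ → ℕ
U []       = 0
U (x ∷ xs) = nzEven x + U xs

maxL : List ℕ → ℕ
maxL = foldr _⊔_ 0

GrowsFrom : ℕ → List ℕ → Set
GrowsFrom m []       = ⊤
GrowsFrom m (x ∷ xs) = (x ≤ suc m) × GrowsFrom (m ⊔ x) xs

IsRGF : List ℕ → Set
IsRGF []       = ⊤
IsRGF (x ∷ xs) = (x ≡ 0) × GrowsFrom 0 xs

InR : ℕ → ℕ → List ℕ → Set
InR n b t = (length t ≡ n) × IsRGF t × All (_≤ b) t

-- co-Reflected Gray Code order; u accumulates the count U of nonzero even
-- entries in the common prefix scanned so far
data CoRGC (u : ℕ) : List ℕ → List ℕ → Set where
  here-even : ∀ {x y xs ys} → Even u → x < y → CoRGC u (x ∷ xs) (y ∷ ys)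
  here-odd  : ∀ {x y xs ys} → Odd u  → y < x → CoRGC u (x ∷ xs) (y ∷ ys)
  there     : ∀ {x xs ys} → CoRGC (u + nzEven x) xs ys → CoRGC u (x ∷ xs) (x ∷ ys)

_⋖_ : List ℕ → List ℕ → Set
s ⋖ t = CoRGC 0 s t

HasPrefix : List ℕ → List ℕ → Set
HasPrefix s t = ∃ λ r → t ≡ s ++ r

IsLastWithPrefix : ℕ → ℕ → List ℕ → List ℕ → Set
IsLastWithPrefix n b s t =
  InR n b t × HasPrefix s t ×
  (∀ v → InR n b v → HasPrefix s v → (v ≡ t) ⊎ (v ⋖ t))

module Submission where

-- Write the last sequence as t = s ++ r.  Any candidate suffix
-- c for which s ++ c lies in R_n(b) is compared with t, and since t is last,
-- either c = r or s ++ c ⋖ s ++ r; stripping the common prefix s turns the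
-- latter into r coming after c in the order CoRGC (U s) (lemma pin-suffix).
-- So it suffices to exhibit, in each of the three cases, an admissible
-- candidate c that no admissible suffix r can follow:
--   * U s odd:            c = 0…0, since every move away from 0 is downwards;
--   * U s even, M even:   c = M 0…0, since M is the largest possible entry and
--                         the nonzero even M flips the direction for the zeros;
--   * U s even, M odd:    c = M (M+1) 0…0, since the odd M keeps the direction,
--                         M+1 is the largest entry allowed after M, and the
--                         even M+1 flips the direction for the zeros.

open import Defs
open import Data.Nat using (ℕ; zero; suc; _+_; _≤_; _⊓_; _⊔_; _∸_; z≤n; s≤s)
open import Data.Nat.Properties
open import Data.Nat.Divisibility using (_∣_; _∣?_; divides; ∣-refl; ∣m∣n⇒∣m+n; ∣m+n∣m⇒∣n; ∣1⇒≡1)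
open import Data.List using (List; []; _∷_; _++_; length; replicate)
open import Data.List.Properties using (length-++; length-replicate)
open import Data.List.Relation.Unary.All using (All; []; _∷_)
open import Data.List.Relation.Unary.All.Properties using (++⁺; ++⁻ˡ; ++⁻ʳ; replicate⁺)
open import Data.Product using (_×_; _,_; proj₁; proj₂)
open import Data.Sum using (_⊎_; inj₁; inj₂)
open import Data.Unit using (⊤; tt)
open import Data.Empty using (⊥-elim)
open import Relation.Nullary using (¬_; yes; no)
open import Relation.Binary.PropositionalEquality
  using (_≡_; _≢_; refl; sym; trans; subst; cong)

even-or-even-suc : ∀ n → Even n ⊎ Even (suc n)
even-or-even-suc zero = inj₁ (divides 0 refl)
even-or-even-suc (suc n) with even-or-even-suc n
... | inj₁ even-n     = inj₂ (∣m∣n⇒∣m+n {2} {2} {n} ∣-refl even-n)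
... | inj₂ even-suc-n = inj₁ even-suc-n

odd⇒even-suc : ∀ {n} → Odd n → Even (suc n)
odd⇒even-suc {n} odd-n with even-or-even-suc n
... | inj₁ even-n     = ⊥-elim (odd-n even-n)
... | inj₂ even-suc-n = even-suc-n

-- Two consecutive numbers are never both even: 2 would divide 1.
even⇒odd-+1 : ∀ {n} → Even n → Odd (n + 1)
even⇒odd-+1 {n} even-n even-n+1 with ∣1⇒≡1 (∣m+n∣m⇒∣n {2} {n} {1} even-n+1 even-n)
... | ()

even-odd-distinct : ∀ {m n} → Even m → Odd n → m ≢ n
even-odd-distinct even-m odd-n refl = odd-n even-m

nzEven-even : ∀ {x} → 1 ≤ x → Even x → nzEven x ≡ 1
nzEven-even {suc x} _ even-x with 2 ∣? suc x
... | yes _   = refl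
... | no odd-x = ⊥-elim (odd-x even-x)

nzEven-odd : ∀ {x} → Odd x → nzEven x ≡ 0
nzEven-odd {zero}  odd-x = refl
nzEven-odd {suc x} odd-x with 2 ∣? suc x
... | yes even-x = ⊥-elim (odd-x even-x)
... | no _       = refl

strip-prefix : ∀ {u} xs {ys zs} → CoRGC u (xs ++ ys) (xs ++ zs) → CoRGC (u + U xs) ys zs
strip-prefix {u} [] {ys} {zs} ys⋖zs =
  subst (λ w → CoRGC w ys zs) (sym (+-identityʳ u)) ys⋖zs
strip-prefix (x ∷ xs) (here-even _ x<x) = ⊥-elim (<-irrefl refl x<x)
strip-prefix (x ∷ xs) (here-odd _ x<x)  = ⊥-elim (<-irrefl refl x<x)
strip-prefix {u} (x ∷ xs) {ys} {zs} (there ys⋖zs) =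
  subst (λ w → CoRGC w ys zs) (+-assoc u (nzEven x) (U xs)) (strip-prefix xs ys⋖zs)

HeadAtMost : ℕ → List ℕ → Set
HeadAtMost M []      = ⊤
HeadAtMost M (y ∷ _) = y ≤ M

grows-head : ∀ {m} r → GrowsFrom m r → HeadAtMost (suc m) r
grows-head []      _        = tt
grows-head (_ ∷ _) (y≤ , _) = y≤

-- With an odd count, the direction is downwards, so nothing comes after 0…0.
zeros-last : ∀ {u} j r → Odd u → ¬ CoRGC u (replicate j 0) r
zeros-last (suc j) (y ∷ r) odd-u (here-even even-u _) = odd-u even-u
zeros-last (suc j) (y ∷ r) odd-u (here-odd _ ())
zeros-last {u} (suc j) (.0 ∷ r) odd-u (there zeros⋖r) =
  zeros-last j r (subst Odd (sym (+-identityʳ u)) odd-u) zeros⋖r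

-- With an even count, nothing whose first entry is at most M comes after
-- M 0…0 when M is nonzero even: M is maximal, and after it the count is odd.
peak-last : ∀ {u M} j r → Even u → nzEven M ≡ 1 → HeadAtMost M r →
  ¬ CoRGC u (M ∷ replicate j 0) r
peak-last j (y ∷ r) _ _ y≤M (here-even _ M<y) = <⇒≱ M<y y≤M
peak-last j (y ∷ r) even-u _ _ (here-odd odd-u _) = odd-u even-u
peak-last {u} j (_ ∷ r) even-u [M]≡1 _ (there zeros⋖r) =
  zeros-last j r (subst (λ w → Odd (u + w)) (sym [M]≡1) (even⇒odd-+1 even-u)) zeros⋖r

-- With an even count, nothing growing from a maximum m ≤ M and starting with
-- an entry at most M comes after M (M+1) 0…0 when M is odd: M is maximal and
-- keeps the count even, and then M+1 is the largest entry allowed after M.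
odd-peak-last : ∀ {u m M} j r → Even u → Odd M → m ≤ M → HeadAtMost M r →
  GrowsFrom m r → ¬ CoRGC u (M ∷ suc M ∷ replicate j 0) r
odd-peak-last j (y ∷ r) _ _ _ y≤M _ (here-even _ M<y) = <⇒≱ M<y y≤M
odd-peak-last j (y ∷ r) even-u _ _ _ _ (here-odd odd-u _) = odd-u even-u
odd-peak-last {u} {M = M} j (_ ∷ r) even-u odd-M m≤M _ (_ , r-grows) (there rest⋖r) =
  peak-last j r even-u+[M] (nzEven-even (s≤s z≤n) (odd⇒even-suc odd-M)) head-r rest⋖r
  where
  even-u+[M] : Even (u + nzEven M)
  even-u+[M] = subst (λ w → Even (u + w)) (sym (nzEven-odd odd-M))
                     (subst Even (sym (+-identityʳ u)) even-u)
  head-r : HeadAtMost (suc M) r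
  head-r = subst (λ w → HeadAtMost (suc w) r) (m≤n⇒m⊔n≡n m≤M) (grows-head r r-grows)

grows-++⁻ : ∀ m xs {ys} → GrowsFrom m (xs ++ ys) → GrowsFrom (m ⊔ maxL xs) ys
grows-++⁻ m [] {ys} grows = subst (λ w → GrowsFrom w ys) (sym (⊔-identityʳ m)) grows
grows-++⁻ m (x ∷ xs) {ys} (_ , grows) =
  subst (λ w → GrowsFrom w ys) (⊔-assoc m x (maxL xs)) (grows-++⁻ (m ⊔ x) xs grows)

grows-++⁺ : ∀ m xs {ys zs} → GrowsFrom m (xs ++ ys) → GrowsFrom (m ⊔ maxL xs) zs →
  GrowsFrom m (xs ++ zs)
grows-++⁺ m [] {zs = zs} _ grows = subst (λ w → GrowsFrom w zs) (⊔-identityʳ m) grows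
grows-++⁺ m (x ∷ xs) {zs = zs} (x≤ , grows) grows′ =
  x≤ , grows-++⁺ (m ⊔ x) xs grows (subst (λ w → GrowsFrom w zs) (sym (⊔-assoc m x (maxL xs))) grows′)

rgf-suffix-grows : ∀ s {r} → 1 ≤ length s → IsRGF (s ++ r) → GrowsFrom (maxL s) r
rgf-suffix-grows (x ∷ xs) _ (refl , grows) = grows-++⁻ 0 xs grows

first-entry-capped : ∀ {b m} r → All (_≤ b) r → GrowsFrom m r → HeadAtMost (b ⊓ suc m) r
first-entry-capped []      _           _        = tt
first-entry-capped (y ∷ _) (y≤b ∷ _) (y≤ , _) = ⊓-glb y≤b y≤

zeros-grow : ∀ m j → GrowsFrom m (replicate j 0)
zeros-grow m zero    = tt
zeros-grow m (suc j) = z≤n , zeros-grow (m ⊔ 0) j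

maxL-bounded : ∀ {b} xs → All (_≤ b) xs → maxL xs ≤ b
maxL-bounded []       []         = z≤n
maxL-bounded (x ∷ xs) (x≤b ∷ xs≤b) = ⊔-lub x≤b (maxL-bounded xs xs≤b)

replace-suffix : ∀ {n b} s {r c} → 1 ≤ length s → InR n b (s ++ r) →
  length c ≡ length r → GrowsFrom (maxL s) c → All (_≤ b) c → InR n b (s ++ c)
replace-suffix (x ∷ xs) {r} {c} _ (len , (refl , grows) , bounded) |c|≡|r| c-grows c-bounded =
    trans (length-++ (x ∷ xs)) (trans (cong (length (x ∷ xs) +_) |c|≡|r|)
                                      (trans (sym (length-++ (x ∷ xs))) len))
  , (refl , grows-++⁺ 0 xs grows c-grows)
  , ++⁺ (++⁻ˡ (x ∷ xs) bounded) c-bounded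

pin-suffix : ∀ {n b} s {r c} → 1 ≤ length s → IsLastWithPrefix n b s (s ++ r) →
  length c ≡ length r → GrowsFrom (maxL s) c → All (_≤ b) c →
  ¬ CoRGC (U s) c r → s ++ r ≡ s ++ c
pin-suffix s k≥1 (t∈R , _ , last) |c|≡|r| c-grows c-bounded r-not-after-c
  with last _ (replace-suffix s k≥1 t∈R |c|≡|r| c-grows c-bounded) (_ , refl)
... | inj₁ c≡r = sym c≡r
... | inj₂ c⋖r = ⊥-elim (r-not-after-c (strip-prefix s c⋖r))

suffix-lengths : ∀ k n → k + 2 ≤ n →
  (suc (n ∸ k ∸ 1) ≡ n ∸ k) × (suc (suc (n ∸ k ∸ 2)) ≡ n ∸ k)
suffix-lengths zero    (suc (suc n)) _        = refl , refl
suffix-lengths zero    (suc zero)    (s≤s ())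
suffix-lengths (suc k) (suc n)       (s≤s p)  = suffix-lengths k n p

proposition3 : (b n : ℕ) (s t : List ℕ) → 2 ≤ b → Even b →
    1 ≤ length s → length s + 2 ≤ n → IsLastWithPrefix n b s t →
    ((Even (U s) × Even (b ⊓ suc (maxL s))) →
        t ≡ s ++ (b ⊓ suc (maxL s)) ∷ replicate (n ∸ length s ∸ 1) 0)
    × ((Even (U s) × Odd (b ⊓ suc (maxL s))) →
        t ≡ s ++ (b ⊓ suc (maxL s)) ∷ suc (b ⊓ suc (maxL s)) ∷ replicate (n ∸ length s ∸ 2) 0)
    × (Odd (U s) → t ≡ s ++ replicate (n ∸ length s) 0)
proposition3 b n s t 2≤b even-b k≥1 k+2≤n is-last@((len , rgf , bounded) , (r , refl) , _) =
    (λ (even-U , even-M) →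
      pin (trans (cong suc (length-replicate j₁)) (proj₁ lengths))
          (m⊓n≤n b (suc m) , zeros-grow _ j₁) (M≤b ∷ replicate⁺ j₁ z≤n)
          (peak-last j₁ r even-U (nzEven-even 1≤M even-M) head-r))
  , (λ (even-U , odd-M) →
      pin (trans (cong (λ w → suc (suc w)) (length-replicate j₂)) (proj₂ lengths))
          (m⊓n≤n b (suc m) , s≤s (m≤n⊔m m M) , zeros-grow _ j₂)
          (M≤b ∷ ≤∧≢⇒< M≤b (λ M≡b → even-odd-distinct even-b odd-M (sym M≡b)) ∷ replicate⁺ j₂ z≤n)
          (odd-peak-last j₂ r even-U odd-M m≤M head-r r-grows))
  , (λ odd-U →
      pin (length-replicate j₀) (zeros-grow m j₀) (replicate⁺ j₀ z≤n)
          (zeros-last j₀ r odd-U))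
  where
  k m M j₀ j₁ j₂ : ℕ
  k = length s
  m = maxL s
  M = b ⊓ suc m
  j₀ = n ∸ k
  j₁ = n ∸ k ∸ 1
  j₂ = n ∸ k ∸ 2
  r-length : n ∸ k ≡ length r
  r-length = trans (cong (_∸ k) (sym (trans (sym (length-++ s {r})) len))) (m+n∸m≡n k (length r))
  pin : ∀ {c} → length c ≡ n ∸ k → GrowsFrom m c → All (_≤ b) c →
    ¬ CoRGC (U s) c r → s ++ r ≡ s ++ c
  pin c-length = pin-suffix s k≥1 is-last (trans c-length r-length)
  lengths : (suc j₁ ≡ n ∸ k) × (suc (suc j₂) ≡ n ∸ k)
  lengths = suffix-lengths k n k+2≤n
  r-grows : GrowsFrom m r
  r-grows = rgf-suffix-grows s k≥1 rgf
  head-r : HeadAtMost M r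
  head-r = first-entry-capped r (++⁻ʳ s bounded) r-grows
  M≤b : M ≤ b
  M≤b = m⊓n≤m b (suc m)
  m≤M : m ≤ M
  m≤M = ⊓-glb (maxL-bounded s (++⁻ˡ s bounded)) (n≤1+n m)
  1≤M : 1 ≤ M
  1≤M = ⊓-glb (≤-trans (s≤s z≤n) 2≤b) (s≤s z≤n)
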